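{- If $v$ is a simplicial vertex of an $\alpha$-excellent graph $G$, then $G-N_G[v]$ is an $\alpha$-excellent graph.
   Context: All graphs are finite and simple. A vertex $v$ is simplicial if every two vertices of $N_G(v)$ are adjacent; $N_G[v]$ is the closed neighborhood. A graph is $\alpha$-excellent if every vertex is contained in some maximum independent set. -}

module Defs where

open import Data.Nat using (ℕ; _≤_)
open import Data.Bool using (Bool; true; false; _∨_)
open import Data.Fin using (Fin)
open import Data.Fin.Subset using (Subset; _∈_; _∉_; _⊆_; ∣_∣; ∁; ⊤)
open import Data.Vec using (tabulate)
open import Data.Product using (Σ; _×_)
open import Relation.Binary.PropositionalEquality using (_≡_; _≢_)
open import Relation.Nullary.Decidable using (⌊_⌋)
open import Data.Fin using (_≟_)

record Graph (n : ℕ) : Set where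
  field
    adj   : Fin n → Fin n → Bool
    sym   : ∀ u v → adj u v ≡ adj v u
    irrefl : ∀ v → adj v v ≡ false
open Graph public

module _ {n : ℕ} (G : Graph n) where

  Adjacent : Fin n → Fin n → Set
  Adjacent u v = adj G u v ≡ true

  Simplicial : Fin n → Set
  Simplicial v = ∀ x y → Adjacent v x → Adjacent v y → x ≢ y → Adjacent x y

  closedNbhd : Fin n → Subset n
  closedNbhd v = tabulate (λ u → ⌊ u ≟ v ⌋ ∨ adj G u v)

  Independent : Subset n → Set
  Independent S = ∀ x y → x ∈ S → y ∈ S → adj G x y ≡ false

  -- Properties of the induced subgraph G[W] (vertex set W ⊆ V(G)).
  -- Independent sets of G[W] are exactly the independent sets of G inside W.
  MaximumIndepIn : Subset n → Subset n → Set
  MaximumIndepIn W S =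
    S ⊆ W × Independent S × (∀ T → T ⊆ W → Independent T → ∣ T ∣ ≤ ∣ S ∣)

  AlphaExcellentOn : Subset n → Set
  AlphaExcellentOn W = ∀ v → v ∈ W → Σ (Subset n) (λ S → MaximumIndepIn W S × v ∈ S)

  AlphaExcellent : Set
  AlphaExcellent = AlphaExcellentOn ⊤

  DeleteClosedNbhdAlphaExcellent : Fin n → Set
  DeleteClosedNbhdAlphaExcellent v = AlphaExcellentOn (∁ (closedNbhd v))

{-# OPTIONS --safe #-}
-- Since v is simplicial, N[v] is a clique, so a maximum independent set S of G
-- through a vertex u ∉ N[v] meets N[v] in at most one vertex: S ∖ N[v] still
-- contains u and has size at least α(G) − 1.  Conversely, v has no neighbour in
-- G − N[v], so every independent set T of G − N[v] extends to the independent
-- set T ∪ {v} of G, whence |T| + 1 ≤ α(G) ≤ |S ∖ N[v]| + 1.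
module Submission where

open import Defs hiding (sym)
open import Data.Nat using (ℕ; suc; _+_; _≤_; _<_; z≤n)
open import Data.Nat.Properties using (+-suc; +-monoˡ-≤; m<1+n⇒m≤n; module ≤-Reasoning)
open import Data.Bool using (true; false; _∨_)
open import Data.Bool.Properties using (∨-zeroʳ; ¬-not)
open import Data.Fin using (Fin; _≟_)
open import Data.Fin.Subset
open import Data.Fin.Subset.Properties
open import Data.Vec using (_∷_; []; lookup)
open import Data.Vec.Properties using (lookup∘tabulate; lookup⇒[]=; []=⇒lookup)
open import Data.Product using (_,_)
open import Data.Sum using (_⊎_; inj₁; inj₂)
open import Relation.Nullary using (yes; no; contradiction; ⌊_⌋)
open import Relation.Nullary.Decidable using (isYes≗does; dec-true)
open import Relation.Binary.PropositionalEquality using (_≡_; _≢_; refl; sym; trans; cong)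

private
  variable
    n : ℕ

∣p∣≡∣p∩q∣+∣p∩∁q∣ : ∀ (p q : Subset n) → ∣ p ∣ ≡ ∣ p ∩ q ∣ + ∣ p ∩ ∁ q ∣
∣p∣≡∣p∩q∣+∣p∩∁q∣ []            []            = refl
∣p∣≡∣p∩q∣+∣p∩∁q∣ (inside  ∷ p) (inside  ∷ q) = cong suc (∣p∣≡∣p∩q∣+∣p∩∁q∣ p q)
∣p∣≡∣p∩q∣+∣p∩∁q∣ (inside  ∷ p) (outside ∷ q) =
  trans (cong suc (∣p∣≡∣p∩q∣+∣p∩∁q∣ p q)) (sym (+-suc ∣ p ∩ q ∣ ∣ p ∩ ∁ q ∣))
∣p∣≡∣p∩q∣+∣p∩∁q∣ (outside ∷ p) (_       ∷ q) = ∣p∣≡∣p∩q∣+∣p∩∁q∣ p q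

subsingleton⇒∣p∣≤1 : ∀ {n} {p : Subset n} → (∀ {x y} → x ∈ p → y ∈ p → x ≡ y) → ∣ p ∣ ≤ 1
subsingleton⇒∣p∣≤1 {n} {p} unique with nonempty? p
... | yes (x , x∈p) = begin
  ∣ p ∣     ≤⟨ p⊆q⇒∣p∣≤∣q∣ (λ y∈p → subst-⁅⁆ (unique y∈p x∈p)) ⟩
  ∣ ⁅ x ⁆ ∣ ≡⟨ ∣⁅x⁆∣≡1 x ⟩
  1         ∎
  where
  open ≤-Reasoning
  subst-⁅⁆ : ∀ {y} → y ≡ x → y ∈ ⁅ x ⁆
  subst-⁅⁆ refl = x∈⁅x⁆ x
... | no ∅ rewrite Empty-unique ∅ | ∣⊥∣≡0 n = z≤n

∣p∣<∣p∪⁅x⁆∣ : ∀ {p : Subset n} {x} → x ∉ p → ∣ p ∣ < ∣ p ∪ ⁅ x ⁆ ∣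
∣p∣<∣p∪⁅x⁆∣ {x = x} x∉p =
  p⊂q⇒∣p∣<∣q∣ (p⊆p∪q ⁅ x ⁆ , x , x∈p∪q⁺ (inj₂ (x∈⁅x⁆ x)) , x∉p)

module _ {n : ℕ} (G : Graph n) where

  Clique : Subset n → Set
  Clique K = ∀ {x y} → x ∈ K → y ∈ K → x ≢ y → Adjacent G x y

  adjacent-sym : ∀ {x y} → Adjacent G x y → Adjacent G y x
  adjacent-sym {x} {y} x~y = trans (Graph.sym G y x) x~y

  independent-⊆ : ∀ {R S} → R ⊆ S → Independent G S → Independent G R
  independent-⊆ R⊆S indS x y x∈R y∈R = indS x y (R⊆S x∈R) (R⊆S y∈R)

  independent∩clique-unique : ∀ {S K} → Independent G S → Clique K →
                              ∀ {x y} → x ∈ S ∩ K → y ∈ S ∩ K → x ≡ y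
  independent∩clique-unique {S} {K} indS clique {x} {y} x∈S∩K y∈S∩K with x ≟ y
  ... | yes x≡y = x≡y
  ... | no  x≢y with x∈p∩q⁻ S K x∈S∩K | x∈p∩q⁻ S K y∈S∩K
  ... | x∈S , x∈K | y∈S , y∈K with () ← trans (sym (clique x∈K y∈K x≢y)) (indS x y x∈S y∈S)

  ∣independent∣≤1+∣independent∖clique∣ : ∀ {S K} → Independent G S → Clique K →
                                        ∣ S ∣ ≤ suc ∣ S ∩ ∁ K ∣
  ∣independent∣≤1+∣independent∖clique∣ {S} {K} indS clique = begin
    ∣ S ∣                       ≡⟨ ∣p∣≡∣p∩q∣+∣p∩∁q∣ S K ⟩
    ∣ S ∩ K ∣ + ∣ S ∩ ∁ K ∣     ≤⟨ +-monoˡ-≤ ∣ S ∩ ∁ K ∣ ∣S∩K∣≤1 ⟩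
    suc ∣ S ∩ ∁ K ∣             ∎
    where
    open ≤-Reasoning
    ∣S∩K∣≤1 : ∣ S ∩ K ∣ ≤ 1
    ∣S∩K∣≤1 = subsingleton⇒∣p∣≤1 (independent∩clique-unique indS clique)

  independent-∪-⁅⁆ : ∀ {T v} → Independent G T → (∀ x → x ∈ T → adj G x v ≡ false) →
                     Independent G (T ∪ ⁅ v ⁆)
  independent-∪-⁅⁆ {T} {v} indT T≁v x y x∈ y∈ with x∈p∪q⁻ T ⁅ v ⁆ x∈ | x∈p∪q⁻ T ⁅ v ⁆ y∈
  ... | inj₁ x∈T | inj₁ y∈T = indT x y x∈T y∈T
  ... | inj₁ x∈T | inj₂ y∈v rewrite x∈⁅y⁆⇒x≡y v y∈v = T≁v x x∈T
  ... | inj₂ x∈v | inj₁ y∈T rewrite x∈⁅y⁆⇒x≡y v x∈v = trans (Graph.sym G v y) (T≁v y y∈T)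
  ... | inj₂ x∈v | inj₂ y∈v rewrite x∈⁅y⁆⇒x≡y v x∈v | x∈⁅y⁆⇒x≡y v y∈v = Graph.irrefl G v

  module _ {v : Fin n} where

    lookup-closedNbhd : ∀ x → lookup (closedNbhd G v) x ≡ (⌊ x ≟ v ⌋ ∨ adj G x v)
    lookup-closedNbhd = lookup∘tabulate _

    ∈closedNbhd⁺ : ∀ {x} → x ≡ v ⊎ Adjacent G x v → x ∈ closedNbhd G v
    ∈closedNbhd⁺ {x} (inj₁ refl) =
      lookup⇒[]= x _ (trans (lookup-closedNbhd x) (cong (_∨ adj G x v) x≟x-isYes))
      where
      x≟x-isYes : ⌊ x ≟ x ⌋ ≡ true
      x≟x-isYes = trans (isYes≗does (x ≟ x)) (dec-true (x ≟ x) refl)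
    ∈closedNbhd⁺ {x} (inj₂ x~v) =
      lookup⇒[]= x _ (trans (lookup-closedNbhd x) (trans (cong (⌊ x ≟ v ⌋ ∨_) x~v) (∨-zeroʳ _)))

    ∈closedNbhd⁻ : ∀ {x} → x ∈ closedNbhd G v → x ≡ v ⊎ Adjacent G x v
    ∈closedNbhd⁻ {x} x∈N with x ≟ v | trans (sym (lookup-closedNbhd x)) ([]=⇒lookup x∈N)
    ... | yes x≡v | _    = inj₁ x≡v
    ... | no  _   | x~v  = inj₂ x~v

    ∉closedNbhd⇒nonadjacent : ∀ {x} → x ∉ closedNbhd G v → adj G x v ≡ false
    ∉closedNbhd⇒nonadjacent x∉N = ¬-not (λ x~v → x∉N (∈closedNbhd⁺ (inj₂ x~v)))

    simplicial⇒closedNbhd-clique : Simplicial G v → Clique (closedNbhd G v)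
    simplicial⇒closedNbhd-clique simplicial {x} {y} x∈N y∈N x≢y
      with ∈closedNbhd⁻ x∈N | ∈closedNbhd⁻ y∈N
    ... | inj₁ refl | inj₁ refl = contradiction refl x≢y
    ... | inj₁ refl | inj₂ y~v  = adjacent-sym y~v
    ... | inj₂ x~v  | inj₁ refl = x~v
    ... | inj₂ x~v  | inj₂ y~v  = simplicial x y (adjacent-sym x~v) (adjacent-sym y~v) x≢y

proposition4p4 : ∀ {n : ℕ} (G : Graph n) (v : Fin n)
    → Simplicial G v → AlphaExcellent G → DeleteClosedNbhdAlphaExcellent G v
proposition4p4 G v simplicial excellent u u∈W with excellent u ∈⊤
... | S , (_ , indS , maximumS) , u∈S =
  S ∩ W , (p∩q⊆q S W , independent-⊆ G (p∩q⊆p S W) indS , maximum) , x∈p∩q⁺ (u∈S , u∈W)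
  where
  W = ∁ (closedNbhd G v)

  maximum : ∀ T → T ⊆ W → Independent G T → ∣ T ∣ ≤ ∣ S ∩ W ∣
  maximum T T⊆W indT = m<1+n⇒m≤n (begin-strict
    ∣ T ∣            <⟨ ∣p∣<∣p∪⁅x⁆∣ (λ v∈T → x∈∁p⇒x∉p (T⊆W v∈T) (∈closedNbhd⁺ G (inj₁ refl))) ⟩
    ∣ T ∪ ⁅ v ⁆ ∣    ≤⟨ maximumS (T ∪ ⁅ v ⁆) (λ _ → ∈⊤) indT∪v ⟩
    ∣ S ∣            ≤⟨ ∣independent∣≤1+∣independent∖clique∣ G indS N[v]-clique ⟩
    suc ∣ S ∩ W ∣    ∎)
    where
    open ≤-Reasoning
    N[v]-clique : Clique G (closedNbhd G v)
    N[v]-clique = simplicial⇒closedNbhd-clique G simplicial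
    indT∪v : Independent G (T ∪ ⁅ v ⁆)
    indT∪v = independent-∪-⁅⁆ G indT (λ x x∈T → ∉closedNbhd⇒nonadjacent G (x∈∁p⇒x∉p (T⊆W x∈T)))
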